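{- For every integer $n\ge 0$, $sp(2n+1)\equiv 2n+1 \pmod 4$.
   Context: $sp(n)$ is defined by $sp(0)=sp(1)=1$ and, for $n>1$, $sp(n)=sp(n/2)$ if $n$ is even and $sp(n)=2sp(n-1)+sp(n-2)$ if $n$ is odd. (It counts semi-Pell compositions of $n$.) -}

module Defs where

open import Data.Nat.Base using (ℕ; zero; suc; _+_; _*_; ⌊_/2⌋)
open import Data.Bool.Base using (Bool; true; false)

isEven : ℕ → Bool
isEven zero          = true
isEven (suc zero)    = false
isEven (suc (suc k)) = isEven k

-- Semi-Pell numbers sp(n):
--   sp 0 = sp 1 = 1,
--   sp n = sp (n/2)              if n > 1 is even,
--   sp n = 2 sp(n-1) + sp(n-2)   if n > 1 is odd.
-- Defined with a fuel argument f so that the recursion is structural;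
-- spF f n follows the recurrence whenever f > n (all recursive calls are on
-- smaller arguments), and sp n uses fuel suc n.
spF : ℕ → ℕ → ℕ
spF zero    _             = 1
spF (suc f) zero          = 1
spF (suc f) (suc zero)    = 1
spF (suc f) (suc (suc m)) with isEven m
... | true  = spF f ⌊ suc (suc m) /2⌋
... | false = 2 * spF f (suc m) + spF f m

sp : ℕ → ℕ
sp n = spF (suc n) n

-- Every semi-Pell number is odd, so at an odd index 2n+3 the recurrence gives
-- sp(2n+3) = 2 sp(2n+2) + sp(2n+1) ≡ 2 + sp(2n+1) (mod 4), and induction on n
-- from sp 1 = 1 yields sp(2n+1) ≡ 2n+1 (mod 4).
module Submission where

open import Defs
open import Data.Nat.Base using (ℕ; zero; suc; _+_; _*_; _%_; _<_; s≤s)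
open import Data.Nat.Properties using (<-trans; n<1+n)
open import Data.Nat.DivMod using ([m+kn]%n≡m%n)
open import Data.Nat.Tactic.RingSolver using (solve-∀)
open import Data.Bool.Base using (true; false)
open import Data.Product using (∃; _,_)
open import Relation.Binary.PropositionalEquality using (_≡_; refl; sym; cong; module ≡-Reasoning)

-- The n-th odd number, defined so that odd (suc n) reduces to suc (suc (odd n)),
-- the shape on which spF unfolds.
odd : ℕ → ℕ
odd zero    = 1
odd (suc n) = suc (suc (odd n))

odd≡2*n+1 : ∀ n → odd n ≡ 2 * n + 1
odd≡2*n+1 zero = refl
odd≡2*n+1 (suc n) rewrite odd≡2*n+1 n = step n
  where
  step : ∀ n → suc (suc (2 * n + 1)) ≡ 2 * suc n + 1
  step = solve-∀

isEven-odd : ∀ n → isEven (odd n) ≡ false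
isEven-odd zero    = refl
isEven-odd (suc n) = isEven-odd n

spF-odd : ∀ f n → ∃ λ k → spF f n ≡ odd k
spF-odd zero    n             = 0 , refl
spF-odd (suc f) zero          = 0 , refl
spF-odd (suc f) (suc zero)    = 0 , refl
spF-odd (suc f) (suc (suc m)) with isEven m
... | true  = spF-odd f _
... | false with spF-odd f m
... | k , sp-m≡odd-k rewrite sp-m≡odd-k = spF f (suc m) + k , recurrence (spF f (suc m)) k
  where
  recurrence : ∀ x k → 2 * x + odd k ≡ odd (x + k)
  recurrence x k rewrite odd≡2*n+1 k | odd≡2*n+1 (x + k) = ring x k
    where
    ring : ∀ x k → 2 * x + (2 * k + 1) ≡ 2 * (x + k) + 1
    ring = solve-∀

-- Fuel exceeding the index is all the recursion needs; sp uses fuel suc (odd n).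
spF-odd-index≡index-mod4 : ∀ n f → odd n < f → ∃ λ k → spF f (odd n) ≡ odd n + k * 4
spF-odd-index≡index-mod4 zero    (suc f) _ = 0 , refl
spF-odd-index≡index-mod4 (suc n) (suc f) (s≤s odd-n+1<f)
  rewrite isEven-odd n
  with spF-odd f (suc (odd n))
     | spF-odd-index≡index-mod4 n f (<-trans (n<1+n _) odd-n+1<f)
... | a , even-term | b , odd-term rewrite even-term | odd-term =
  a + b , recurrence a b (odd n)
  where
  recurrence : ∀ a b x → 2 * odd a + (x + b * 4) ≡ suc (suc x) + (a + b) * 4
  recurrence a b x rewrite odd≡2*n+1 a = ring a b x
    where
    ring : ∀ a b x → 2 * (2 * a + 1) + (x + b * 4) ≡ suc (suc x) + (a + b) * 4
    ring = solve-∀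

theorem1p4 : (n : ℕ) → sp (2 * n + 1) % 4 ≡ (2 * n + 1) % 4
theorem1p4 n with spF-odd-index≡index-mod4 n (suc (odd n)) (n<1+n _)
... | k , sp≡ rewrite sym (odd≡2*n+1 n) = begin
  spF (suc (odd n)) (odd n) % 4 ≡⟨ cong (_% 4) sp≡ ⟩
  (odd n + k * 4) % 4           ≡⟨ [m+kn]%n≡m%n (odd n) k 4 ⟩
  odd n % 4                     ∎
  where open ≡-Reasoning
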